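{- Let $t \equiv 4$ or $8 \pmod{12}$ and let $\mathcal{T}$ be a resolvable Steiner quadruple system $\mathrm{SQS}(t)$ on $\mathbb{Z}_t$. For a parallel class $\mathcal{R}$ of $\mathcal{T}$ and $j,k \in \mathbb{Z}_2$, define six sets $\mathcal{R}_{0,j,k},\dots,\mathcal{R}_{5,j,k}$ of $4$-subsets of $\mathbb{Z}_t\times\mathbb{Z}_2$ by taking, for each block $\{x_1,x_2,x_3,x_4\}\in\mathcal{R}$ (with $x_1<x_2<x_3<x_4$), the two blocks (second coordinates in $\mathbb{Z}_2$): in $\mathcal{R}_{0,j,k}$: $\{(x_1,0),(x_1,1),(x_2,j),(x_3,k)\}$, $\{(x_2,j+1),(x_3,k+1),(x_4,0),(x_4,1)\}$; in $\mathcal{R}_{1,j,k}$: $\{(x_1,0),(x_1,1),(x_2,j),(x_4,k)\}$, $\{(x_2,j+1),(x_3,0),(x_3,1),(x_4,k+1)\}$; in $\mathcal{R}_{2,j,k}$: $\{(x_1,0),(x_1,1),(x_3,j),(x_4,k)\}$, $\{(x_2,0),(x_2,1),(x_3,j+1),(x_4,k+1)\}$; in $\mathcal{R}_{3,j,k}$: $\{(x_1,j),(x_2,0),(x_2,1),(x_3,k)\}$, $\{(x_1,j+1),(x_3,k+1),(x_4,0),(x_4,1)\}$; in $\mathcal{R}_{4,j,k}$: $\{(x_1,j),(x_2,0),(x_2,1),(x_4,k)\}$, $\{(x_1,j+1),(x_3,0),(x_3,1),(x_4,k+1)\}$; in $\mathcal{R}_{5,j,k}$: $\{(x_1,j),(x_2,k),(x_3,0),(x_3,1)\}$,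 $\{(x_1,j+1),(x_2,k+1),(x_4,0),(x_4,1)\}$. Then each $\mathcal{R}_{i,j,k}$ ($i\in\mathbb{Z}_6$, $j,k\in\mathbb{Z}_2$) is a parallel class on $\mathbb{Z}_t\times\mathbb{Z}_2$ in which every block $\{(y_1,\ell_1),\dots,(y_4,\ell_4)\}$ satisfies $|\{y_1,y_2,y_3,y_4\}|=3$; any two classes $\mathcal{R}_{i,j,k}$ and $\mathcal{R}'_{m,r,s}$ with $\mathcal{R}\ne\mathcal{R}'$ or $(i,j,k)\neq(m,r,s)$ are disjoint; and the total number of such parallel classes is $4(t-1)(t-2)$.
   Context: A Steiner quadruple system $\mathrm{SQS}(v)$ is a set of $4$-subsets (blocks) of a $v$-set such that every $3$-subset is contained in exactly one block. It is resolvable if its blocks can be partitioned into parallel classes, i.e. sets of pairwise disjoint blocks whose union is the whole point set. A parallel class on a set $V$ is a set of pairwise disjoint $4$-subsets of $V$ whose union is $V$. -}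

module Defs where

open import Data.Nat using (ℕ; _*_)
open import Data.Fin using (Fin; zero; suc; combine)
open import Data.Fin.Subset using (Subset; ∣_∣; _∈_; _⊆_; _∩_; _∪_; ⁅_⁆; Empty)
open import Data.Fin.Subset.Properties using (_∈?_)
open import Data.Bool using (_∨_)
open import Data.Vec using (tabulate; lookup)
open import Data.List using (List; []; _∷_; filter; concatMap; allFin)
open import Data.List.Membership.Propositional renaming (_∈_ to _∈ₗ_)
open import Data.List.Relation.Unary.All using (All)
open import Data.List.Relation.Unary.AllPairs using (AllPairs)
open import Data.List.Relation.Unary.Unique.Propositional using (Unique)
open import Data.List.Relation.Binary.Permutation.Propositional using (_↭_)
open import Data.Product using (Σ; ∃; _×_; _,_)
open import Relation.Binary.PropositionalEquality using (_≡_)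

Disjoint : ∀ {n} → Subset n → Subset n → Set
Disjoint p q = Empty (p ∩ q)

-- A parallel class on the point set Fin n: a (finite) set of pairwise
-- disjoint 4-subsets whose union is the whole of Fin n.
-- (Pairwise disjointness of the list entries also forces them distinct,
-- as 4-subsets are nonempty.)
IsParallelClass : ∀ {n} → List (Subset n) → Set
IsParallelClass {n} R =
  All (λ b → ∣ b ∣ ≡ 4) R ×
  AllPairs Disjoint R ×
  (∀ (p : Fin n) → ∃ λ b → b ∈ₗ R × p ∈ b)

IsSQS : (v : ℕ) → List (Subset v) → Set
IsSQS v B =
  Unique B ×
  All (λ b → ∣ b ∣ ≡ 4) B ×
  (∀ (T : Subset v) → ∣ T ∣ ≡ 3 →
     (∃ λ b → b ∈ₗ B × T ⊆ b) ×
     (∀ b b′ → b ∈ₗ B → b′ ∈ₗ B → T ⊆ b → T ⊆ b′ → b ≡ b′))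

IsResolution : ∀ {v} → List (Subset v) → List (List (Subset v)) → Set
IsResolution B rs = All IsParallelClass rs × (Data.List.concat rs ↭ B)
  where import Data.List

elems : ∀ {n} → Subset n → List (Fin n)
elems {n} p = filter (_∈? p) (allFin n)

inc₂ : Fin 2 → Fin 2
inc₂ zero = suc zero
inc₂ (suc zero) = zero

-- The point (x , ℓ) of Z_t × Z_2, encoded in Fin (t * 2) via the
-- standard bijection `combine`.
pt : ∀ {t} → Fin t → Fin 2 → Fin (t * 2)
pt x ℓ = combine x ℓ

quad : ∀ {m} → Fin m → Fin m → Fin m → Fin m → Subset m
quad a b c d = ⁅ a ⁆ ∪ (⁅ b ⁆ ∪ (⁅ c ⁆ ∪ ⁅ d ⁆))

private
  o l : Fin 2
  o = zero
  l = suc zero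

newBlocks : ∀ {t} → Fin 6 → Fin 2 → Fin 2 → Fin t → Fin t → Fin t → Fin t
          → List (Subset (t * 2))
newBlocks zero j k x₁ x₂ x₃ x₄ =
  quad (pt x₁ o) (pt x₁ l) (pt x₂ j) (pt x₃ k) ∷
  quad (pt x₂ (inc₂ j)) (pt x₃ (inc₂ k)) (pt x₄ o) (pt x₄ l) ∷ []
newBlocks (suc zero) j k x₁ x₂ x₃ x₄ =
  quad (pt x₁ o) (pt x₁ l) (pt x₂ j) (pt x₄ k) ∷
  quad (pt x₂ (inc₂ j)) (pt x₃ o) (pt x₃ l) (pt x₄ (inc₂ k)) ∷ []
newBlocks (suc (suc zero)) j k x₁ x₂ x₃ x₄ =
  quad (pt x₁ o) (pt x₁ l) (pt x₃ j) (pt x₄ k) ∷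
  quad (pt x₂ o) (pt x₂ l) (pt x₃ (inc₂ j)) (pt x₄ (inc₂ k)) ∷ []
newBlocks (suc (suc (suc zero))) j k x₁ x₂ x₃ x₄ =
  quad (pt x₁ j) (pt x₂ o) (pt x₂ l) (pt x₃ k) ∷
  quad (pt x₁ (inc₂ j)) (pt x₃ (inc₂ k)) (pt x₄ o) (pt x₄ l) ∷ []
newBlocks (suc (suc (suc (suc zero)))) j k x₁ x₂ x₃ x₄ =
  quad (pt x₁ j) (pt x₂ o) (pt x₂ l) (pt x₄ k) ∷
  quad (pt x₁ (inc₂ j)) (pt x₃ o) (pt x₃ l) (pt x₄ (inc₂ k)) ∷ []
newBlocks (suc (suc (suc (suc (suc zero))))) j k x₁ x₂ x₃ x₄ =
  quad (pt x₁ j) (pt x₂ k) (pt x₃ o) (pt x₃ l) ∷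
  quad (pt x₁ (inc₂ j)) (pt x₂ (inc₂ k)) (pt x₄ o) (pt x₄ l) ∷ []

-- Blocks contributed by a block b; b is read as x₁<x₂<x₃<x₄ via `elems`
-- (for a non-4-subset, which never occurs here, nothing is produced).
blockImage : ∀ {t} → Fin 6 → Fin 2 → Fin 2 → Subset t → List (Subset (t * 2))
blockImage i j k b with elems b
... | x₁ ∷ x₂ ∷ x₃ ∷ x₄ ∷ [] = newBlocks i j k x₁ x₂ x₃ x₄
... | _ = []

classRijk : ∀ {t} → List (Subset t) → Fin 6 → Fin 2 → Fin 2 → List (Subset (t * 2))
classRijk R i j k = concatMap (blockImage i j k) R

proj : ∀ t → Subset (t * 2) → Subset t
proj t B = tabulate (λ y → lookup B (pt y zero) ∨ lookup B (pt y (suc zero)))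

allClasses : ∀ {t} → List (List (Subset t)) → List (List (Subset (t * 2)))
allClasses rs =
  concatMap (λ R → concatMap (λ i → concatMap (λ j → concatMap (λ k →
    classRijk R i j k ∷ []) (allFin 2)) (allFin 2)) (allFin 6)) rs

-- Each block x₁ < x₂ < x₃ < x₄ of a parallel class R contributes to R_{i,j,k} two 4-subsets of
-- {x₁,…,x₄} × Z₂ that partition it and each project onto three of the xᵢ. These are finite facts
-- about twelve block patterns, decided by evaluation once transported along the enumeration of
-- the block; as R partitions Z_t, R_{i,j,k} partitions Z_t × Z₂. A new block projects onto a
-- 3-subset of its original block, which therefore is the unique block of the SQS containing it,
-- lies in a unique class of the resolution, and together with the pattern of the new block
-- determines (i,j,k); so distinct classes are disjoint. Double counting ordered triples of
-- distinct points gives 24|B| = t(t-1)(t-2) and counting points gives 4|R| = t, so the resolution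
-- has (t-1)(t-2)/6 parallel classes, each giving rise to 24 new ones.

module Submission where

open import Defs
open import Data.Bool using (Bool; true; false; _∧_; _∨_; not)
import Data.Bool.Properties as 𝔹
open import Data.Empty using (⊥; ⊥-elim)
open import Data.Fin using (Fin; zero; suc)
open import Data.Fin.Patterns using (0F; 1F; 2F; 3F; 4F; 5F)
open import Data.Fin.Properties using (_≟_; all?; any?; combine-injective; combine-surjective)
open import Data.Fin.Subset using (Subset; ∣_∣; ⁅_⁆; _∪_; _⊆_) renaming (_∈_ to _∈ₛ_)
open import Data.Fin.Subset.Properties using (_∈?_; x∈p∪q⁺; x∈p∪q⁻; x∈p∩q⁺; x∈p∩q⁻; x∈⁅x⁆; x∈⁅y⁆⇒x≡y)
open import Data.List using (List; []; _∷_; _++_; length; lookup; concat; concatMap; allFin)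
open import Data.List.Properties using (length-++)
open import Data.List.Membership.Propositional using (_∈_; _∉_; find; lose)
open import Data.List.Membership.Propositional.Properties
  using (∈-lookup; ∈-allFin; ∈-filter⁺; ∈-filter⁻; ∈-++⁺ʳ; ∈-concat⁺′; ∈-concatMap⁺; ∈-concatMap⁻)
open import Data.List.Relation.Binary.Permutation.Propositional using (↭-sym; ↭⇒↭ₛ)
open import Data.List.Relation.Binary.Permutation.Propositional.Properties using (↭-length; ∈-resp-↭)
import Data.List.Relation.Binary.Permutation.Setoid.Properties as PermutationSetoid
open import Data.List.Relation.Unary.All as All using (All; []; _∷_)
open import Data.List.Relation.Unary.AllPairs as AllPairs using (AllPairs; []; _∷_)
import Data.List.Relation.Unary.AllPairs.Properties as AllPairs
open import Data.List.Relation.Unary.Any as Any using (Any; here; there)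
open import Data.List.Relation.Unary.Any.Properties using (lookup-index)
open import Data.List.Relation.Unary.Unique.Propositional using (Unique)
import Data.List.Relation.Unary.Unique.Propositional.Properties as Unique
open import Data.Nat using (ℕ; zero; suc; _+_; _*_; _∸_; _%_; NonZero)
open import Data.Nat.Properties as ℕ
  using (+-identityʳ; +-assoc; *-identityʳ; *-zeroʳ; *-assoc; *-comm; *-distribʳ-+; *-distribˡ-+;
         *-cancelˡ-≡; m+n∸n≡m; ∸-+-assoc)
open import Algebra.Properties.CommutativeMonoid.Sum ℕ.+-0-commutativeMonoid
  using (sum-syntax; sum-cong-≗; sum-replicate-zero; ∑-comm; ∑-distrib-+)
open import Data.Product using (_×_; _,_; ∃; proj₁; proj₂)
open import Data.Sum using (_⊎_; inj₁; inj₂)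
import Data.Vec as Vec
open import Data.Vec.Properties using (lookup-replicate; lookup-zipWith; lookup∘tabulate; []=⇒lookup; lookup⇒[]=)
open import Function using (_∘_; id)
open import Relation.Nullary using (yes; no; contradiction)
open import Relation.Nullary.Decidable using (does; dec-true; dec-false; toWitness; _×-dec_; _→-dec_)
open import Relation.Binary.PropositionalEquality
  using (_≡_; _≢_; refl; sym; trans; cong; cong₂; subst; setoid)
open Relation.Binary.PropositionalEquality.≡-Reasoning

-- Indicator sums

_∈ᵇ_ : ∀ {n} → Fin n → Subset n → Bool
x ∈ᵇ p = Vec.lookup p x

_≟ᵇ_ : ∀ {n} → Fin n → Fin n → Bool
x ≟ᵇ y = does (x ≟ y)

𝟙 : Bool → ℕ
𝟙 true  = 1
𝟙 false = 0

𝟙-∧ : ∀ a b → 𝟙 (a ∧ b) ≡ 𝟙 a * 𝟙 b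
𝟙-∧ true  b = sym (+-identityʳ (𝟙 b))
𝟙-∧ false b = refl

∧₃-true : ∀ a b c → (a ∧ b ∧ c) ≡ true → a ≡ true × b ≡ true × c ≡ true
∧₃-true true true true _ = refl , refl , refl

𝟙-guard : ∀ a {m n} → (a ≡ true → m ≡ n) → 𝟙 a * m ≡ 𝟙 a * n
𝟙-guard true  m≡n = cong (_+ 0) (m≡n refl)
𝟙-guard false _   = refl

∈ₛ⇒∈ᵇ : ∀ {n} {x : Fin n} {p} → x ∈ₛ p → x ∈ᵇ p ≡ true
∈ₛ⇒∈ᵇ = []=⇒lookup

∈ᵇ⇒∈ₛ : ∀ {n} {x : Fin n} {p} → x ∈ᵇ p ≡ true → x ∈ₛ p
∈ᵇ⇒∈ₛ {x = x} {p} = lookup⇒[]= x p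

∈ᵇ-⁅⁆ : ∀ {n} (x y : Fin n) → y ∈ᵇ ⁅ x ⁆ ≡ x ≟ᵇ y
∈ᵇ-⁅⁆ zero    zero    = refl
∈ᵇ-⁅⁆ zero    (suc y) = lookup-replicate y false
∈ᵇ-⁅⁆ (suc x) zero    = refl
∈ᵇ-⁅⁆ (suc x) (suc y) = ∈ᵇ-⁅⁆ x y

∈ᵇ-∪ : ∀ {n} (p q : Subset n) x → x ∈ᵇ (p ∪ q) ≡ (x ∈ᵇ p ∨ x ∈ᵇ q)
∈ᵇ-∪ p q x = lookup-zipWith _∨_ x p q

∑-const : ∀ n c → ∑[ i < n ] c ≡ n * c
∑-const zero    c = refl
∑-const (suc n) c = cong (c +_) (∑-const n c)

∑-*ʳ : ∀ {n} (f : Fin n → ℕ) c → ∑[ i < n ] (f i * c) ≡ (∑[ i < n ] f i) * c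
∑-*ʳ {zero}  f c = refl
∑-*ʳ {suc n} f c = trans (cong (f zero * c +_) (∑-*ʳ (f ∘ suc) c)) (sym (*-distribʳ-+ c (f zero) _))

∑-*ˡ : ∀ {n} c (f : Fin n → ℕ) → ∑[ i < n ] (c * f i) ≡ c * ∑[ i < n ] f i
∑-*ˡ {zero}  c f = sym (*-zeroʳ c)
∑-*ˡ {suc n} c f = trans (cong (c * f zero +_) (∑-*ˡ c (f ∘ suc))) (sym (*-distribˡ-+ c (f zero) _))

∑-δ : ∀ {n} (x : Fin n) (g : Fin n → ℕ) → ∑[ y < n ] (𝟙 (y ≟ᵇ x) * g y) ≡ g x
∑-δ {suc n} zero    g = trans (cong₂ _+_ (+-identityʳ (g zero)) (sum-replicate-zero n)) (+-identityʳ (g zero))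
∑-δ {suc n} (suc x) g = ∑-δ x (g ∘ suc)

≟ᵇ-sym : ∀ {n} (x y : Fin n) → x ≟ᵇ y ≡ y ≟ᵇ x
≟ᵇ-sym x y with x ≟ y
... | yes refl = sym (dec-true (x ≟ x) refl)
... | no x≢y   = sym (dec-false (y ≟ x) (x≢y ∘ sym))

≟ᵇ-injective : ∀ {k n} {x : Fin k → Fin n} → (∀ {a b} → x a ≡ x b → a ≡ b) →
               ∀ a b → x a ≟ᵇ x b ≡ a ≟ᵇ b
≟ᵇ-injective {x = x} inj a b with a ≟ b
... | yes refl = dec-true (x a ≟ x a) refl
... | no a≢b   = dec-false (x a ≟ x b) (a≢b ∘ inj)

∑-image : ∀ {k n} (x : Fin k → Fin n) → (∀ {a b} → x a ≡ x b → a ≡ b) →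
          (g : Fin n → ℕ) → (∀ y → (∀ a → x a ≢ y) → g y ≡ 0) →
          ∑[ y < n ] g y ≡ ∑[ a < k ] g (x a)
∑-image {k} {n} x inj g g-outside = begin
  ∑[ y < n ] g y                               ≡⟨ sum-cong-≗ spread ⟩
  ∑[ y < n ] ∑[ a < k ] (𝟙 (y ≟ᵇ x a) * g y)  ≡⟨ ∑-comm (λ y a → 𝟙 (y ≟ᵇ x a) * g y) ⟩
  ∑[ a < k ] ∑[ y < n ] (𝟙 (y ≟ᵇ x a) * g y)  ≡⟨ sum-cong-≗ (λ a → ∑-δ (x a) g) ⟩
  ∑[ a < k ] g (x a)                           ∎
  where
  spread : ∀ y → g y ≡ ∑[ a < k ] (𝟙 (y ≟ᵇ x a) * g y)
  spread y with any? (λ a → x a ≟ y)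
  ... | yes (b , refl) = sym (begin
    ∑[ a < k ] (𝟙 (x b ≟ᵇ x a) * g (x b))
      ≡⟨ sum-cong-≗ (λ a → cong (λ e → 𝟙 e * g (x b)) (≟ᵇ-injective inj b a)) ⟩
    ∑[ a < k ] (𝟙 (b ≟ᵇ a) * g (x b))
      ≡⟨ sum-cong-≗ (λ a → cong (λ e → 𝟙 e * g (x b)) (≟ᵇ-sym b a)) ⟩
    ∑[ a < k ] (𝟙 (a ≟ᵇ b) * g (x b))
      ≡⟨ ∑-δ b (λ _ → g (x b)) ⟩
    g (x b)
      ∎)
  ... | no ∄a = begin
    g y                              ≡⟨ gy≡0 ⟩
    0                                ≡⟨ sum-replicate-zero k ⟨
    ∑[ a < k ] 0                     ≡⟨ sum-cong-≗ (λ a → trans (cong (𝟙 (y ≟ᵇ x a) *_) gy≡0) (*-zeroʳ (𝟙 (y ≟ᵇ x a)))) ⟨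
    ∑[ a < k ] (𝟙 (y ≟ᵇ x a) * g y) ∎
    where
    gy≡0 : g y ≡ 0
    gy≡0 = g-outside y (λ a xa≡y → ∄a (a , xa≡y))

∑-pt : ∀ {t} (f : Fin (t * 2) → ℕ) →
       ∑[ p < t * 2 ] f p ≡ ∑[ y < t ] (f (pt y 0F) + f (pt y 1F))
∑-pt {zero}  f = refl
∑-pt {suc t} f = trans (sym (+-assoc (f zero) (f (suc zero)) _))
                       (cong (f zero + f (suc zero) +_) (∑-pt {t} (λ p → f (suc (suc p)))))

count : ∀ {n} → (Fin n → Bool) → ℕ
count {n} q = ∑[ x < n ] 𝟙 (q x)

∣p∣≡count : ∀ {n} (p : Subset n) → ∣ p ∣ ≡ count (_∈ᵇ p)
∣p∣≡count Vec.[]            = refl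
∣p∣≡count (true  Vec.∷ p) = cong suc (∣p∣≡count p)
∣p∣≡count (false Vec.∷ p) = ∣p∣≡count p

count-all : ∀ n → count {n} (λ _ → true) ≡ n
count-all n = trans (∑-const n 1) (*-identityʳ n)

_without_ : ∀ {n} → (Fin n → Bool) → Fin n → (Fin n → Bool)
(q without x) y = q y ∧ not (x ≟ᵇ y)

count-without : ∀ {n} (q : Fin n → Bool) {x} → q x ≡ true → count (q without x) ≡ count q ∸ 1
count-without {n} q {x} qx = sym (begin
  count q ∸ 1
    ≡⟨ cong (_∸ 1) (sum-cong-≗ split) ⟩
  ∑[ y < n ] (𝟙 ((q without x) y) + 𝟙 (y ≟ᵇ x) * 𝟙 (q y)) ∸ 1
    ≡⟨ cong (_∸ 1) (∑-distrib-+ (𝟙 ∘ (q without x)) (λ y → 𝟙 (y ≟ᵇ x) * 𝟙 (q y))) ⟩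
  count (q without x) + ∑[ y < n ] (𝟙 (y ≟ᵇ x) * 𝟙 (q y)) ∸ 1
    ≡⟨ cong (λ m → count (q without x) + m ∸ 1) (∑-δ x (𝟙 ∘ q)) ⟩
  count (q without x) + 𝟙 (q x) ∸ 1
    ≡⟨ cong (λ b → count (q without x) + 𝟙 b ∸ 1) qx ⟩
  count (q without x) + 1 ∸ 1
    ≡⟨ m+n∸n≡m _ 1 ⟩
  count (q without x)
    ∎)
  where
  split : ∀ y → 𝟙 (q y) ≡ 𝟙 ((q without x) y) + 𝟙 (y ≟ᵇ x) * 𝟙 (q y)
  split y rewrite ≟ᵇ-sym y x with q y | x ≟ᵇ y
  ... | true  | true  = refl
  ... | true  | false = refl
  ... | false | true  = refl
  ... | false | false = refl

distinct₃ : ∀ {n} → Fin n → Fin n → Fin n → Bool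
distinct₃ x y z = not (x ≟ᵇ y) ∧ not (x ≟ᵇ z) ∧ not (y ≟ᵇ z)

≟ᵇ-≢ : ∀ {n} {x y : Fin n} → not (x ≟ᵇ y) ≡ true → x ≢ y
≟ᵇ-≢ {x = x} {y} x≠y x≡y = contradiction (trans (sym x≠y) (cong not (dec-true (x ≟ y) x≡y))) λ ()

distinct₃⇒≢ : ∀ {n} {x y z : Fin n} → distinct₃ x y z ≡ true → x ≢ y × x ≢ z × y ≢ z
distinct₃⇒≢ {x = x} {y} {z} d
  with xy , xz , yz ← ∧₃-true (not (x ≟ᵇ y)) (not (x ≟ᵇ z)) (not (y ≟ᵇ z)) d = ≟ᵇ-≢ xy , ≟ᵇ-≢ xz , ≟ᵇ-≢ yz

orderedTriples : ∀ {n} → (Fin n → Bool) → ℕ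
orderedTriples {n} q = ∑[ x < n ] ∑[ y < n ] ∑[ z < n ] 𝟙 ((q x ∧ q y ∧ q z) ∧ distinct₃ x y z)

∧-regroup : ∀ a b c d e f → (a ∧ b ∧ c) ∧ (d ∧ e ∧ f) ≡ (a ∧ (b ∧ d)) ∧ ((c ∧ e) ∧ f)
∧-regroup false b     c     d     e f = refl
∧-regroup true  false c     d     e f = refl
∧-regroup true  true  false false e f = refl
∧-regroup true  true  false true  e f = refl
∧-regroup true  true  true  d     e f = refl

orderedTriples≡ : ∀ {n} (q : Fin n → Bool) → orderedTriples q ≡ count q * ((count q ∸ 1) * (count q ∸ 2))
orderedTriples≡ {n} q = begin
  orderedTriples q
    ≡⟨ sum-cong-≗ (λ x → sum-cong-≗ (λ y → sum-cong-≗ (λ z →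
         cong 𝟙 (∧-regroup (q x) (q y) (q z) (not (x ≟ᵇ y)) (not (x ≟ᵇ z)) (not (y ≟ᵇ z)))))) ⟩
  ∑[ x < n ] ∑[ y < n ] ∑[ z < n ] 𝟙 ((q x ∧ (q without x) y) ∧ ((q without x) without y) z)
    ≡⟨ sum-cong-≗ (λ x → sum-cong-≗ (λ y → sum-over-z x y)) ⟩
  ∑[ x < n ] ∑[ y < n ] (𝟙 (q x ∧ (q without x) y) * (N ∸ 2))
    ≡⟨ sum-cong-≗ sum-over-y ⟩
  ∑[ x < n ] (𝟙 (q x) * ((N ∸ 1) * (N ∸ 2)))
    ≡⟨ ∑-*ʳ (𝟙 ∘ q) _ ⟩
  N * ((N ∸ 1) * (N ∸ 2))
    ∎
  where
  N : ℕ
  N = count q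

  sum-over-z : ∀ x y → ∑[ z < n ] 𝟙 ((q x ∧ (q without x) y) ∧ ((q without x) without y) z)
                       ≡ 𝟙 (q x ∧ (q without x) y) * (N ∸ 2)
  sum-over-z x y = begin
    ∑[ z < n ] 𝟙 (a ∧ ((q without x) without y) z)
      ≡⟨ sum-cong-≗ (λ z → 𝟙-∧ a (((q without x) without y) z)) ⟩
    ∑[ z < n ] (𝟙 a * 𝟙 (((q without x) without y) z))
      ≡⟨ ∑-*ˡ (𝟙 a) (𝟙 ∘ ((q without x) without y)) ⟩
    𝟙 a * count ((q without x) without y)
      ≡⟨ 𝟙-guard a remove-two ⟩
    𝟙 a * (N ∸ 2)
      ∎
    where
    a : Bool
    a = q x ∧ (q without x) y
    remove-two : a ≡ true → count ((q without x) without y) ≡ N ∸ 2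
    remove-two _ with q x in qx | (q without x) y in qy
    ... | true | true = begin
      count ((q without x) without y) ≡⟨ count-without (q without x) qy ⟩
      count (q without x) ∸ 1         ≡⟨ cong (_∸ 1) (count-without q qx) ⟩
      N ∸ 1 ∸ 1                       ≡⟨ ∸-+-assoc N 1 1 ⟩
      N ∸ 2                           ∎

  sum-over-y : ∀ x → ∑[ y < n ] (𝟙 (q x ∧ (q without x) y) * (N ∸ 2)) ≡ 𝟙 (q x) * ((N ∸ 1) * (N ∸ 2))
  sum-over-y x = begin
    ∑[ y < n ] (𝟙 (q x ∧ (q without x) y) * (N ∸ 2))
      ≡⟨ ∑-*ʳ (λ y → 𝟙 (q x ∧ (q without x) y)) (N ∸ 2) ⟩
    (∑[ y < n ] 𝟙 (q x ∧ (q without x) y)) * (N ∸ 2)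
      ≡⟨ cong (_* (N ∸ 2)) (sum-cong-≗ (λ y → 𝟙-∧ (q x) ((q without x) y))) ⟩
    (∑[ y < n ] (𝟙 (q x) * 𝟙 ((q without x) y))) * (N ∸ 2)
      ≡⟨ cong (_* (N ∸ 2)) (∑-*ˡ (𝟙 (q x)) (𝟙 ∘ (q without x))) ⟩
    𝟙 (q x) * count (q without x) * (N ∸ 2)
      ≡⟨ cong (_* (N ∸ 2)) (𝟙-guard (q x) (count-without q)) ⟩
    𝟙 (q x) * (N ∸ 1) * (N ∸ 2)
      ≡⟨ *-assoc (𝟙 (q x)) (N ∸ 1) (N ∸ 2) ⟩
    𝟙 (q x) * ((N ∸ 1) * (N ∸ 2))
      ∎

sumᴸ : ∀ {a} {A : Set a} → List A → (A → ℕ) → ℕ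
sumᴸ []       f = 0
sumᴸ (x ∷ xs) f = f x + sumᴸ xs f

infix 10 sumᴸ
syntax sumᴸ xs (λ x → e) = ∑[ x ∈ xs ] e

module _ {a} {A : Set a} where

  ∑ᴸ-cong : ∀ (xs : List A) {f g : A → ℕ} → (∀ {x} → x ∈ xs → f x ≡ g x) → sumᴸ xs f ≡ sumᴸ xs g
  ∑ᴸ-cong []       f≡g = refl
  ∑ᴸ-cong (x ∷ xs) f≡g = cong₂ _+_ (f≡g (here refl)) (∑ᴸ-cong xs (f≡g ∘ there))

  ∑ᴸ-const : ∀ (xs : List A) c → ∑[ x ∈ xs ] c ≡ length xs * c
  ∑ᴸ-const []       c = refl
  ∑ᴸ-const (x ∷ xs) c = cong (c +_) (∑ᴸ-const xs c)

  ∑ᴸ-*ʳ : ∀ (xs : List A) (f : A → ℕ) c → sumᴸ xs f * c ≡ ∑[ x ∈ xs ] (f x * c)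
  ∑ᴸ-*ʳ []       f c = refl
  ∑ᴸ-*ʳ (x ∷ xs) f c = trans (*-distribʳ-+ c (f x) _) (cong (f x * c +_) (∑ᴸ-*ʳ xs f c))

  ∑-∑ᴸ-comm : ∀ {n} (xs : List A) (f : Fin n → A → ℕ) →
              ∑[ i < n ] ∑[ x ∈ xs ] f i x ≡ ∑[ x ∈ xs ] ∑[ i < n ] f i x
  ∑-∑ᴸ-comm {n} []       f = sum-replicate-zero n
  ∑-∑ᴸ-comm     (x ∷ xs) f = trans (∑-distrib-+ (λ i → f i x) (λ i → sumᴸ xs (f i)))
                                    (cong (∑[ i < _ ] f i x +_) (∑-∑ᴸ-comm xs f))

  Exclusive : (A → Bool) → A → A → Set
  Exclusive P x y = P x ≡ true → P y ≡ true → ⊥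

  ∑ᴸ-𝟙≡0 : ∀ (P : A → Bool) {xs} → All (λ x → P x ≡ false) xs → ∑[ x ∈ xs ] 𝟙 (P x) ≡ 0
  ∑ᴸ-𝟙≡0 P []             = refl
  ∑ᴸ-𝟙≡0 P (Px≡false ∷ ¬P) = cong₂ _+_ (cong 𝟙 Px≡false) (∑ᴸ-𝟙≡0 P ¬P)

  ∑ᴸ-𝟙≡1 : ∀ (P : A → Bool) {xs} → AllPairs (Exclusive P) xs → Any (λ x → P x ≡ true) xs →
           ∑[ x ∈ xs ] 𝟙 (P x) ≡ 1
  ∑ᴸ-𝟙≡1 P (x⊥xs ∷ _) (here Px) =
    cong₂ _+_ (cong 𝟙 Px) (∑ᴸ-𝟙≡0 P (All.map (λ x⊥y → 𝔹.¬-not (x⊥y Px)) x⊥xs))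
  ∑ᴸ-𝟙≡1 P (x⊥xs ∷ exclusive) (there any) =
    cong₂ _+_ (cong 𝟙 (𝔹.¬-not (λ Px → All.lookupWith (λ x⊥y Py → x⊥y Px Py) x⊥xs any)))
              (∑ᴸ-𝟙≡1 P exclusive any)

  exclusive-from-unique : ∀ (P : A → Bool) {xs} → Unique xs →
                          (∀ {u v} → u ∈ xs → v ∈ xs → P u ≡ true → P v ≡ true → u ≡ v) →
                          AllPairs (Exclusive P) xs
  exclusive-from-unique P []               _           = []
  exclusive-from-unique P (x∉xs ∷ unique) at-most-one =
    All.tabulate (λ v∈xs Px Pv → All.lookup x∉xs v∈xs (at-most-one (here refl) (there v∈xs) Px Pv)) ∷
    exclusive-from-unique P unique (λ u∈xs v∈xs → at-most-one (there u∈xs) (there v∈xs))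

lookup-injective : ∀ {a} {A : Set a} {xs : List A} → Unique xs →
                   ∀ {i j} → lookup xs i ≡ lookup xs j → i ≡ j
lookup-injective {xs = _ ∷ _} _             {zero}  {zero}  _  = refl
lookup-injective {xs = _ ∷ _} (x∉xs ∷ _)    {zero}  {suc j} eq = ⊥-elim (All.lookup x∉xs (∈-lookup j) eq)
lookup-injective {xs = _ ∷ _} (x∉xs ∷ _)    {suc i} {zero}  eq = ⊥-elim (All.lookup x∉xs (∈-lookup i) (sym eq))
lookup-injective {xs = _ ∷ _} (_ ∷ unique)  {suc i} {suc j} eq = cong suc (lookup-injective unique eq)

∣p∣≡length : ∀ {n} {p : Subset n} {xs : List (Fin n)} → Unique xs →
             (∀ {y} → y ∈ₛ p → y ∈ xs) → (∀ {y} → y ∈ xs → y ∈ₛ p) → ∣ p ∣ ≡ length xs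
∣p∣≡length {n} {p} {xs} unique p⊆xs xs⊆p = begin
  ∣ p ∣
    ≡⟨ ∣p∣≡count p ⟩
  ∑[ y < n ] 𝟙 (y ∈ᵇ p)
    ≡⟨ ∑-image (lookup xs) (lookup-injective unique) (𝟙 ∘ (_∈ᵇ p)) outside ⟩
  ∑[ i < length xs ] 𝟙 (lookup xs i ∈ᵇ p)
    ≡⟨ sum-cong-≗ (λ i → cong 𝟙 (∈ₛ⇒∈ᵇ (xs⊆p (∈-lookup i)))) ⟩
  ∑[ i < length xs ] 1
    ≡⟨ ∑-const (length xs) 1 ⟩
  length xs * 1
    ≡⟨ *-identityʳ (length xs) ⟩
  length xs
    ∎
  where
  outside : ∀ y → (∀ i → lookup xs i ≢ y) → 𝟙 (y ∈ᵇ p) ≡ 0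
  outside y y∉xs with y ∈ᵇ p in y∈ᵇp
  ... | false = refl
  ... | true  = ⊥-elim (y∉xs (Any.index y∈xs) (sym (lookup-index y∈xs)))
    where
    y∈xs : y ∈ xs
    y∈xs = p⊆xs (∈ᵇ⇒∈ₛ y∈ᵇp)

module _ {a b} {A : Set a} {B : Set b} where

  AllPairs-concatMap⁺ : ∀ {p q r} {P : A → Set p} {Q : A → A → Set q} {S : B → B → Set r} (f : A → List B) {xs} →
    All P xs → AllPairs Q xs → (∀ {x} → P x → AllPairs S (f x)) →
    (∀ {x y} → P x → P y → Q x y → ∀ {u v} → u ∈ f x → v ∈ f y → S u v) →
    AllPairs S (concatMap f xs)
  AllPairs-concatMap⁺ f []         []         inner cross = []
  AllPairs-concatMap⁺ f (px ∷ pxs) (qx ∷ qxs) inner cross =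
    AllPairs.++⁺ (inner px) (AllPairs-concatMap⁺ f pxs qxs inner cross)
      (All.tabulate λ u∈fx → All.tabulate λ v∈rest →
        let y , y∈xs , v∈fy = find (∈-concatMap⁻ f v∈rest)
        in cross px (All.lookup pxs y∈xs) (All.lookup qx y∈xs) u∈fx v∈fy)

module _ {a} {A : Set a} where

  ++-unique-disjoint : ∀ xs {ys} {x : A} → Unique (xs ++ ys) → x ∈ xs → x ∈ ys → ⊥
  ++-unique-disjoint (_ ∷ xs) (x∉ ∷ _)     (here refl)  x∈ys = All.lookup x∉ (∈-++⁺ʳ xs x∈ys) refl
  ++-unique-disjoint (_ ∷ xs) (_ ∷ unique) (there x∈xs) x∈ys = ++-unique-disjoint xs unique x∈xs x∈ys

  ++-unique-right : ∀ xs {ys : List A} → Unique (xs ++ ys) → Unique ys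
  ++-unique-right []       unique       = unique
  ++-unique-right (_ ∷ xs) (_ ∷ unique) = ++-unique-right xs unique

  concat-unique-index : ∀ (xss : List (List A)) → Unique (concat xss) →
                        ∀ a a′ {x} → x ∈ lookup xss a → x ∈ lookup xss a′ → a ≡ a′
  concat-unique-index (xs ∷ xss) unique zero     zero      _   _    = refl
  concat-unique-index (xs ∷ xss) unique zero     (suc a′) x∈  x∈′ =
    ⊥-elim (++-unique-disjoint xs unique x∈ (∈-concat⁺′ x∈′ (∈-lookup {xs = xss} a′)))
  concat-unique-index (xs ∷ xss) unique (suc a)  zero      x∈  x∈′ =
    ⊥-elim (++-unique-disjoint xs unique x∈′ (∈-concat⁺′ x∈ (∈-lookup {xs = xss} a)))
  concat-unique-index (xs ∷ xss) unique (suc a)  (suc a′) x∈  x∈′ =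
    cong suc (concat-unique-index xss (++-unique-right xs unique) a a′ x∈ x∈′)

length-concatMap-const : ∀ {a b} {A : Set a} {B : Set b} (f : A → List B) {c} → (∀ x → length (f x) ≡ c) →
                         ∀ xs → length (concatMap f xs) ≡ length xs * c
length-concatMap-const f f-length []       = refl
length-concatMap-const f f-length (x ∷ xs) =
  trans (length-++ (f x)) (cong₂ _+_ (f-length x) (length-concatMap-const f f-length xs))

length-concat : ∀ {a} {A : Set a} (xss : List (List A)) → length (concat xss) ≡ ∑[ xs ∈ xss ] length xs
length-concat []         = refl
length-concat (xs ∷ xss) = trans (length-++ xs) (cong (length xs +_) (length-concat xss))

-- Counting blocks of Steiner quadruple systems and of parallel classes

triple : ∀ {n} → Fin n → Fin n → Fin n → Subset n
triple x y z = ⁅ x ⁆ ∪ ⁅ y ⁆ ∪ ⁅ z ⁆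

module _ {n} {x y z : Fin n} where

  ∈-triple⁻ : ∀ {w} → w ∈ₛ triple x y z → w ∈ (x ∷ y ∷ z ∷ [])
  ∈-triple⁻ w∈ with x∈p∪q⁻ ⁅ x ⁆ _ w∈
  ... | inj₁ w∈x = here (x∈⁅y⁆⇒x≡y x w∈x)
  ... | inj₂ w∈yz with x∈p∪q⁻ ⁅ y ⁆ _ w∈yz
  ...   | inj₁ w∈y = there (here (x∈⁅y⁆⇒x≡y y w∈y))
  ...   | inj₂ w∈z = there (there (here (x∈⁅y⁆⇒x≡y z w∈z)))

  ∈-triple⁺ : ∀ {w} → w ∈ (x ∷ y ∷ z ∷ []) → w ∈ₛ triple x y z
  ∈-triple⁺ (here refl)                 = x∈p∪q⁺ (inj₁ (x∈⁅x⁆ x))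
  ∈-triple⁺ (there (here refl))         = x∈p∪q⁺ (inj₂ (x∈p∪q⁺ (inj₁ (x∈⁅x⁆ y))))
  ∈-triple⁺ (there (there (here refl))) = x∈p∪q⁺ (inj₂ (x∈p∪q⁺ (inj₂ (x∈⁅x⁆ z))))

  ∣triple∣≡3 : distinct₃ x y z ≡ true → ∣ triple x y z ∣ ≡ 3
  ∣triple∣≡3 distinct = ∣p∣≡length unique ∈-triple⁻ ∈-triple⁺
    where
    unique : Unique (x ∷ y ∷ z ∷ [])
    unique with x≢y , x≢z , y≢z ← distinct₃⇒≢ distinct =
      (x≢y ∷ x≢z ∷ []) ∷ (y≢z ∷ []) ∷ [] ∷ []

  triple⊆⇒ : ∀ {b} → triple x y z ⊆ b → (x ∈ᵇ b ∧ y ∈ᵇ b ∧ z ∈ᵇ b) ≡ true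
  triple⊆⇒ T⊆b
    rewrite ∈ₛ⇒∈ᵇ (T⊆b (∈-triple⁺ (here refl)))
          | ∈ₛ⇒∈ᵇ (T⊆b (∈-triple⁺ (there (here refl))))
          | ∈ₛ⇒∈ᵇ (T⊆b (∈-triple⁺ (there (there (here refl))))) = refl

  ⇒triple⊆ : ∀ {b} → (x ∈ᵇ b ∧ y ∈ᵇ b ∧ z ∈ᵇ b) ≡ true → triple x y z ⊆ b
  ⇒triple⊆ {b} xyz∈b w∈T with x∈b , y∈b , z∈b ← ∧₃-true (x ∈ᵇ b) (y ∈ᵇ b) (z ∈ᵇ b) xyz∈b | ∈-triple⁻ w∈T
  ... | here refl                 = ∈ᵇ⇒∈ₛ x∈b
  ... | there (here refl)         = ∈ᵇ⇒∈ₛ y∈b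
  ... | there (there (here refl)) = ∈ᵇ⇒∈ₛ z∈b

module _ {t} {B : List (Subset t)} (sqs : IsSQS t B) where

  private
    unique : Unique B
    unique = proj₁ sqs

    sizes : All (λ b → ∣ b ∣ ≡ 4) B
    sizes = proj₁ (proj₂ sqs)

    steiner : ∀ T → ∣ T ∣ ≡ 3 →
              (∃ λ b → b ∈ B × T ⊆ b) × (∀ b b′ → b ∈ B → b′ ∈ B → T ⊆ b → T ⊆ b′ → b ≡ b′)
    steiner = proj₂ (proj₂ sqs)

  sqs-triple-in-one-block : ∀ x y z →
    ∑[ b ∈ B ] 𝟙 ((x ∈ᵇ b ∧ y ∈ᵇ b ∧ z ∈ᵇ b) ∧ distinct₃ x y z) ≡ 𝟙 (distinct₃ x y z)
  sqs-triple-in-one-block x y z with distinct₃ x y z in distinct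
  ... | false = ∑ᴸ-𝟙≡0 (λ b → (x ∈ᵇ b ∧ y ∈ᵇ b ∧ z ∈ᵇ b) ∧ false) {B}
                  (All.tabulate (λ {b} _ → 𝔹.∧-zeroʳ (x ∈ᵇ b ∧ y ∈ᵇ b ∧ z ∈ᵇ b)))
  ... | true with (b , b∈B , T⊆b) , at-most-one ← steiner (triple x y z) (∣triple∣≡3 {x = x} {y} {z} distinct) =
    ∑ᴸ-𝟙≡1 P (exclusive-from-unique P unique (λ u∈B v∈B Pu Pv → at-most-one _ _ u∈B v∈B (T⊆ Pu) (T⊆ Pv)))
              (lose b∈B (trans (𝔹.∧-identityʳ _) (triple⊆⇒ T⊆b)))
    where
    P : Subset t → Bool
    P b = (x ∈ᵇ b ∧ y ∈ᵇ b ∧ z ∈ᵇ b) ∧ true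
    T⊆ : ∀ {b} → P b ≡ true → triple x y z ⊆ b
    T⊆ {b} Pb = ⇒triple⊆ {x = x} {y} {z} (trans (sym (𝔹.∧-identityʳ _)) Pb)

  sqs-size : length B * 24 ≡ t * ((t ∸ 1) * (t ∸ 2))
  sqs-size = begin
    length B * 24
      ≡⟨ ∑ᴸ-const B 24 ⟨
    ∑[ b ∈ B ] 24
      ≡⟨ ∑ᴸ-cong B triples-in-block ⟨
    ∑[ b ∈ B ] orderedTriples (_∈ᵇ b)
      ≡⟨ ∑-∑ᴸ-comm B (λ x b → ∑[ y < t ] ∑[ z < t ] 𝟙 ((x ∈ᵇ b ∧ y ∈ᵇ b ∧ z ∈ᵇ b) ∧ distinct₃ x y z)) ⟨
    ∑[ x < t ] ∑[ b ∈ B ] ∑[ y < t ] ∑[ z < t ] 𝟙 ((x ∈ᵇ b ∧ y ∈ᵇ b ∧ z ∈ᵇ b) ∧ distinct₃ x y z)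
      ≡⟨ sum-cong-≗ (λ x → ∑-∑ᴸ-comm B (λ y b → ∑[ z < t ] 𝟙 ((x ∈ᵇ b ∧ y ∈ᵇ b ∧ z ∈ᵇ b) ∧ distinct₃ x y z))) ⟨
    ∑[ x < t ] ∑[ y < t ] ∑[ b ∈ B ] ∑[ z < t ] 𝟙 ((x ∈ᵇ b ∧ y ∈ᵇ b ∧ z ∈ᵇ b) ∧ distinct₃ x y z)
      ≡⟨ sum-cong-≗ (λ x → sum-cong-≗ (λ y → ∑-∑ᴸ-comm B (λ z b → 𝟙 ((x ∈ᵇ b ∧ y ∈ᵇ b ∧ z ∈ᵇ b) ∧ distinct₃ x y z)))) ⟨
    ∑[ x < t ] ∑[ y < t ] ∑[ z < t ] ∑[ b ∈ B ] 𝟙 ((x ∈ᵇ b ∧ y ∈ᵇ b ∧ z ∈ᵇ b) ∧ distinct₃ x y z)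
      ≡⟨ sum-cong-≗ (λ x → sum-cong-≗ (λ y → sum-cong-≗ (sqs-triple-in-one-block x y))) ⟩
    orderedTriples {t} (λ _ → true)
      ≡⟨ orderedTriples≡ {t} (λ _ → true) ⟩
    count {t} (λ _ → true) * ((count {t} (λ _ → true) ∸ 1) * (count {t} (λ _ → true) ∸ 2))
      ≡⟨ cong (λ n → n * ((n ∸ 1) * (n ∸ 2))) (count-all t) ⟩
    t * ((t ∸ 1) * (t ∸ 2))
      ∎
    where
    triples-in-block : ∀ {b} → b ∈ B → orderedTriples (_∈ᵇ b) ≡ 24
    triples-in-block {b} b∈B = begin
      orderedTriples (_∈ᵇ b)                                    ≡⟨ orderedTriples≡ (_∈ᵇ b) ⟩
      count (_∈ᵇ b) * ((count (_∈ᵇ b) ∸ 1) * (count (_∈ᵇ b) ∸ 2)) ≡⟨ cong (λ n → n * ((n ∸ 1) * (n ∸ 2))) ∣b∣≡4 ⟩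
      24                                                        ∎
      where
      ∣b∣≡4 : count (_∈ᵇ b) ≡ 4
      ∣b∣≡4 = trans (sym (∣p∣≡count b)) (All.lookup sizes b∈B)

parallelClass-size : ∀ {n} {R : List (Subset n)} → IsParallelClass R → length R * 4 ≡ n
parallelClass-size {n} {R} (sizes , disjoint , covers) = begin
  length R * 4                     ≡⟨ ∑ᴸ-const R 4 ⟨
  ∑[ b ∈ R ] 4                     ≡⟨ ∑ᴸ-cong R (λ {b} b∈R → trans (sym (All.lookup sizes b∈R)) (∣p∣≡count b)) ⟩
  ∑[ b ∈ R ] ∑[ p < n ] 𝟙 (p ∈ᵇ b) ≡⟨ ∑-∑ᴸ-comm R (λ p b → 𝟙 (p ∈ᵇ b)) ⟨
  ∑[ p < n ] ∑[ b ∈ R ] 𝟙 (p ∈ᵇ b) ≡⟨ sum-cong-≗ in-one-block ⟩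
  ∑[ p < n ] 1                     ≡⟨ count-all n ⟩
  n                                ∎
  where
  in-one-block : ∀ p → ∑[ b ∈ R ] 𝟙 (p ∈ᵇ b) ≡ 1
  in-one-block p with b , b∈R , p∈b ← covers p =
    ∑ᴸ-𝟙≡1 (p ∈ᵇ_)
      (AllPairs.map (λ b⊥c p∈b p∈c → b⊥c (p , x∈p∩q⁺ (∈ᵇ⇒∈ₛ p∈b , ∈ᵇ⇒∈ₛ p∈c))) disjoint)
      (lose b∈R (∈ₛ⇒∈ᵇ p∈b))

resolution-size : ∀ {t} {B : List (Subset t)} {rs} → IsResolution B rs → length B * 4 ≡ length rs * t
resolution-size {t} {B} {rs} (classes , concat↭B) = begin
  length B * 4                   ≡⟨ cong (_* 4) (↭-length concat↭B) ⟨
  length (concat rs) * 4         ≡⟨ cong (_* 4) (length-concat rs) ⟩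
  (∑[ R ∈ rs ] length R) * 4     ≡⟨ ∑ᴸ-*ʳ rs length 4 ⟩
  ∑[ R ∈ rs ] (length R * 4)     ≡⟨ ∑ᴸ-cong rs (parallelClass-size ∘ All.lookup classes) ⟩
  ∑[ R ∈ rs ] t                  ≡⟨ ∑ᴸ-const rs t ⟩
  length rs * t                  ∎

resolution-length : ∀ {t} .{{_ : NonZero t}} {B : List (Subset t)} {rs} →
                    IsSQS t B → IsResolution B rs → length rs * 6 ≡ (t ∸ 1) * (t ∸ 2)
resolution-length {t} {B} {rs} sqs resolution = *-cancelˡ-≡ (length rs * 6) ((t ∸ 1) * (t ∸ 2)) t (begin
  t * (length rs * 6)   ≡⟨ *-assoc t (length rs) 6 ⟨
  t * length rs * 6     ≡⟨ cong (_* 6) (*-comm t (length rs)) ⟩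
  length rs * t * 6     ≡⟨ cong (_* 6) (resolution-size resolution) ⟨
  length B * 4 * 6      ≡⟨ *-assoc (length B) 4 6 ⟩
  length B * 24         ≡⟨ sqs-size sqs ⟩
  t * ((t ∸ 1) * (t ∸ 2)) ∎)

-- Blocks of Z_t × Z₂ built from templates

module _ {n} {p : Subset n} where

  elems-unique : Unique (elems p)
  elems-unique = Unique.filter⁺ (_∈? p) (Unique.allFin⁺ n)

  ∈-elems⁺ : ∀ {x} → x ∈ₛ p → x ∈ elems p
  ∈-elems⁺ {x} x∈p = ∈-filter⁺ (_∈? p) (∈-allFin x) x∈p

  ∈-elems⁻ : ∀ {x} → x ∈ elems p → x ∈ₛ p
  ∈-elems⁻ x∈ = proj₂ (∈-filter⁻ (_∈? p) {xs = allFin n} x∈)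

  ∣p∣≡length-elems : ∣ p ∣ ≡ length (elems p)
  ∣p∣≡length-elems = ∣p∣≡length elems-unique ∈-elems⁺ ∈-elems⁻

pt-≟ᵇ : ∀ {t} (x y : Fin t) (ℓ m : Fin 2) → pt x ℓ ≟ᵇ pt y m ≡ (x ≟ᵇ y ∧ ℓ ≟ᵇ m)
pt-≟ᵇ x y ℓ m with x ≟ y | ℓ ≟ m
... | yes refl | yes refl = dec-true (pt x ℓ ≟ pt x ℓ) refl
... | yes refl | no ℓ≢m   = dec-false (pt x ℓ ≟ pt x m) (ℓ≢m ∘ proj₂ ∘ combine-injective x ℓ x m)
... | no x≢y   | _        = dec-false (pt x ℓ ≟ pt y m) (x≢y ∘ proj₁ ∘ combine-injective x ℓ y m)

∈ᵇ-proj : ∀ {t} (X : Subset (t * 2)) y → y ∈ᵇ proj t X ≡ (pt y 0F ∈ᵇ X ∨ pt y 1F ∈ᵇ X)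
∈ᵇ-proj X y = lookup∘tabulate _ y

pt∈⇒∈proj : ∀ {t} {X : Subset (t * 2)} {y m} → pt y m ∈ₛ X → y ∈ₛ proj t X
pt∈⇒∈proj {X = X} {y} {0F} y0∈X = ∈ᵇ⇒∈ₛ (trans (∈ᵇ-proj X y) (cong (_∨ pt y 1F ∈ᵇ X) (∈ₛ⇒∈ᵇ y0∈X)))
pt∈⇒∈proj {X = X} {y} {1F} y1∈X =
  ∈ᵇ⇒∈ₛ (trans (∈ᵇ-proj X y) (trans (cong (pt y 0F ∈ᵇ X ∨_) (∈ₛ⇒∈ᵇ y1∈X)) (𝔹.∨-zeroʳ (pt y 0F ∈ᵇ X))))

∈proj⁻ : ∀ {t} {X : Subset (t * 2)} {y} → y ∈ₛ proj t X → ∃ λ m → pt y m ∈ₛ X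
∈proj⁻ {X = X} {y} y∈ with pt y 0F ∈ᵇ X in hit₀ | trans (sym (∈ᵇ-proj X y)) (∈ₛ⇒∈ᵇ y∈)
... | true  | _    = 0F , ∈ᵇ⇒∈ₛ hit₀
... | false | hit₁ = 1F , ∈ᵇ⇒∈ₛ hit₁

disjoint-by-proj : ∀ {t} {X Y : Subset (t * 2)} {b c : Subset t} →
                   proj t X ⊆ b → proj t Y ⊆ c → Disjoint b c → Disjoint X Y
disjoint-by-proj {t} {X} {Y} projX⊆b projY⊆c b⊥c (p , p∈X∩Y)
  with y , m , refl ← combine-surjective {t} {2} p
  with y∈X , y∈Y ← x∈p∩q⁻ X Y p∈X∩Y =
  b⊥c (y , x∈p∩q⁺ (projX⊆b (pt∈⇒∈proj y∈X) , projY⊆c (pt∈⇒∈proj y∈Y)))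

∈ᵇ-quad : ∀ {n} (a b c d p : Fin n) → p ∈ᵇ quad a b c d ≡ (a ≟ᵇ p ∨ b ≟ᵇ p ∨ c ≟ᵇ p ∨ d ≟ᵇ p)
∈ᵇ-quad a b c d p = begin
  p ∈ᵇ quad a b c d
    ≡⟨ ∈ᵇ-∪ ⁅ a ⁆ _ p ⟩
  p ∈ᵇ ⁅ a ⁆ ∨ p ∈ᵇ (⁅ b ⁆ ∪ ⁅ c ⁆ ∪ ⁅ d ⁆)
    ≡⟨ cong (p ∈ᵇ ⁅ a ⁆ ∨_) (∈ᵇ-∪ ⁅ b ⁆ _ p) ⟩
  p ∈ᵇ ⁅ a ⁆ ∨ p ∈ᵇ ⁅ b ⁆ ∨ p ∈ᵇ (⁅ c ⁆ ∪ ⁅ d ⁆)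
    ≡⟨ cong (λ e → p ∈ᵇ ⁅ a ⁆ ∨ p ∈ᵇ ⁅ b ⁆ ∨ e) (∈ᵇ-∪ ⁅ c ⁆ _ p) ⟩
  p ∈ᵇ ⁅ a ⁆ ∨ p ∈ᵇ ⁅ b ⁆ ∨ p ∈ᵇ ⁅ c ⁆ ∨ p ∈ᵇ ⁅ d ⁆
    ≡⟨ cong₂ _∨_ (∈ᵇ-⁅⁆ a p) (cong₂ _∨_ (∈ᵇ-⁅⁆ b p) (cong₂ _∨_ (∈ᵇ-⁅⁆ c p) (∈ᵇ-⁅⁆ d p))) ⟩
  a ≟ᵇ p ∨ b ≟ᵇ p ∨ c ≟ᵇ p ∨ d ≟ᵇ p
    ∎

Slot : Set
Slot = Fin 4 × Fin 2

Template : Set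
Template = Slot × Slot × Slot × Slot

instantiate : ∀ {t} → (Fin 4 → Fin t) → Template → Subset (t * 2)
instantiate x ((a₁ , ℓ₁) , (a₂ , ℓ₂) , (a₃ , ℓ₃) , (a₄ , ℓ₄)) =
  quad (pt (x a₁) ℓ₁) (pt (x a₂) ℓ₂) (pt (x a₃) ℓ₃) (pt (x a₄) ℓ₄)

hits : ∀ {t} → (Fin 4 → Fin t) → Template → Fin t → Fin 2 → Bool
hits x ((a₁ , ℓ₁) , (a₂ , ℓ₂) , (a₃ , ℓ₃) , (a₄ , ℓ₄)) y m =
  (x a₁ ≟ᵇ y ∧ ℓ₁ ≟ᵇ m) ∨ (x a₂ ≟ᵇ y ∧ ℓ₂ ≟ᵇ m) ∨ (x a₃ ≟ᵇ y ∧ ℓ₃ ≟ᵇ m) ∨ (x a₄ ≟ᵇ y ∧ ℓ₄ ≟ᵇ m)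

occupies : Template → Fin 4 → Fin 2 → Bool
occupies = hits id

∈ᵇ-instantiate : ∀ {t} (x : Fin 4 → Fin t) c y m → pt y m ∈ᵇ instantiate x c ≡ hits x c y m
∈ᵇ-instantiate x c@((a₁ , ℓ₁) , (a₂ , ℓ₂) , (a₃ , ℓ₃) , (a₄ , ℓ₄)) y m =
  trans (∈ᵇ-quad (pt (x a₁) ℓ₁) (pt (x a₂) ℓ₂) (pt (x a₃) ℓ₃) (pt (x a₄) ℓ₄) (pt y m))
        (cong₂ _∨_ (pt-≟ᵇ (x a₁) y ℓ₁ m) (cong₂ _∨_ (pt-≟ᵇ (x a₂) y ℓ₂ m)
        (cong₂ _∨_ (pt-≟ᵇ (x a₃) y ℓ₃ m) (pt-≟ᵇ (x a₄) y ℓ₄ m))))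

hits-outside : ∀ {t} {x : Fin 4 → Fin t} {y} → (∀ a → x a ≢ y) → ∀ c m → hits x c y m ≡ false
hits-outside {x = x} {y} y∉x ((a₁ , ℓ₁) , (a₂ , ℓ₂) , (a₃ , ℓ₃) , (a₄ , ℓ₄)) m
  rewrite dec-false (x a₁ ≟ y) (y∉x a₁) | dec-false (x a₂ ≟ y) (y∉x a₂)
        | dec-false (x a₃ ≟ y) (y∉x a₃) | dec-false (x a₄ ≟ y) (y∉x a₄) = refl

module _ {t} {x : Fin 4 → Fin t} (injective : ∀ {a b} → x a ≡ x b → a ≡ b) where

  hits-image : ∀ c n m → hits x c (x n) m ≡ occupies c n m
  hits-image ((a₁ , ℓ₁) , (a₂ , ℓ₂) , (a₃ , ℓ₃) , (a₄ , ℓ₄)) n m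
    rewrite ≟ᵇ-injective injective a₁ n | ≟ᵇ-injective injective a₂ n
          | ≟ᵇ-injective injective a₃ n | ≟ᵇ-injective injective a₄ n = refl

  ∑-hits : ∀ (f : Bool → Bool → ℕ) → f false false ≡ 0 → ∀ c →
           ∑[ y < t ] f (hits x c y 0F) (hits x c y 1F) ≡
           ∑[ n < 4 ] f (occupies c n 0F) (occupies c n 1F)
  ∑-hits f f00 c = begin
    ∑[ y < t ] f (hits x c y 0F) (hits x c y 1F)
      ≡⟨ ∑-image x injective _ (λ y y∉x → trans (cong₂ f (hits-outside y∉x c 0F) (hits-outside y∉x c 1F)) f00) ⟩
    ∑[ n < 4 ] f (hits x c (x n) 0F) (hits x c (x n) 1F)
      ≡⟨ sum-cong-≗ (λ n → cong₂ f (hits-image c n 0F) (hits-image c n 1F)) ⟩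
    ∑[ n < 4 ] f (occupies c n 0F) (occupies c n 1F)
      ∎

  ∣instantiate∣ : ∀ c → ∣ instantiate x c ∣ ≡ ∑[ n < 4 ] (𝟙 (occupies c n 0F) + 𝟙 (occupies c n 1F))
  ∣instantiate∣ c = begin
    ∣ instantiate x c ∣
      ≡⟨ ∣p∣≡count (instantiate x c) ⟩
    ∑[ p < t * 2 ] 𝟙 (p ∈ᵇ instantiate x c)
      ≡⟨ ∑-pt {t} (λ p → 𝟙 (p ∈ᵇ instantiate x c)) ⟩
    ∑[ y < t ] (𝟙 (pt y 0F ∈ᵇ instantiate x c) + 𝟙 (pt y 1F ∈ᵇ instantiate x c))
      ≡⟨ sum-cong-≗ (λ y → cong₂ (λ a b → 𝟙 a + 𝟙 b) (∈ᵇ-instantiate x c y 0F) (∈ᵇ-instantiate x c y 1F)) ⟩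
    ∑[ y < t ] (𝟙 (hits x c y 0F) + 𝟙 (hits x c y 1F))
      ≡⟨ ∑-hits (λ a b → 𝟙 a + 𝟙 b) refl c ⟩
    ∑[ n < 4 ] (𝟙 (occupies c n 0F) + 𝟙 (occupies c n 1F))
      ∎

  ∣proj-instantiate∣ : ∀ c → ∣ proj t (instantiate x c) ∣ ≡ ∑[ n < 4 ] 𝟙 (occupies c n 0F ∨ occupies c n 1F)
  ∣proj-instantiate∣ c = begin
    ∣ proj t (instantiate x c) ∣
      ≡⟨ ∣p∣≡count (proj t (instantiate x c)) ⟩
    ∑[ y < t ] 𝟙 (y ∈ᵇ proj t (instantiate x c))
      ≡⟨ sum-cong-≗ (λ y → cong 𝟙 (trans (∈ᵇ-proj (instantiate x c) y)
                             (cong₂ _∨_ (∈ᵇ-instantiate x c y 0F) (∈ᵇ-instantiate x c y 1F)))) ⟩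
    ∑[ y < t ] 𝟙 (hits x c y 0F ∨ hits x c y 1F)
      ≡⟨ ∑-hits (λ a b → 𝟙 (a ∨ b)) refl c ⟩
    ∑[ n < 4 ] 𝟙 (occupies c n 0F ∨ occupies c n 1F)
      ∎


-- The slot (a , ℓ) stands for the point (x_{a+1} , ℓ) of a block x₁ < x₂ < x₃ < x₄, and
-- template i j k h for the h-th of the two blocks it contributes to R_{i,j,k}.

private
  x₁ x₂ x₃ x₄ : Fin 4
  x₁ = 0F
  x₂ = 1F
  x₃ = 2F
  x₄ = 3F

template : Fin 6 → Fin 2 → Fin 2 → Fin 2 → Template
template 0F j k 0F = (x₁ , 0F) , (x₁ , 1F) , (x₂ , j) , (x₃ , k)
template 0F j k 1F = (x₂ , inc₂ j) , (x₃ , inc₂ k) , (x₄ , 0F) , (x₄ , 1F)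
template 1F j k 0F = (x₁ , 0F) , (x₁ , 1F) , (x₂ , j) , (x₄ , k)
template 1F j k 1F = (x₂ , inc₂ j) , (x₃ , 0F) , (x₃ , 1F) , (x₄ , inc₂ k)
template 2F j k 0F = (x₁ , 0F) , (x₁ , 1F) , (x₃ , j) , (x₄ , k)
template 2F j k 1F = (x₂ , 0F) , (x₂ , 1F) , (x₃ , inc₂ j) , (x₄ , inc₂ k)
template 3F j k 0F = (x₁ , j) , (x₂ , 0F) , (x₂ , 1F) , (x₃ , k)
template 3F j k 1F = (x₁ , inc₂ j) , (x₃ , inc₂ k) , (x₄ , 0F) , (x₄ , 1F)
template 4F j k 0F = (x₁ , j) , (x₂ , 0F) , (x₂ , 1F) , (x₄ , k)
template 4F j k 1F = (x₁ , inc₂ j) , (x₃ , 0F) , (x₃ , 1F) , (x₄ , inc₂ k)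
template 5F j k 0F = (x₁ , j) , (x₂ , k) , (x₃ , 0F) , (x₃ , 1F)
template 5F j k 1F = (x₁ , inc₂ j) , (x₂ , inc₂ k) , (x₄ , 0F) , (x₄ , 1F)

newBlocks≡ : ∀ {t} i j k (y₁ y₂ y₃ y₄ : Fin t) →
             newBlocks i j k y₁ y₂ y₃ y₄ ≡
             instantiate (lookup (y₁ ∷ y₂ ∷ y₃ ∷ y₄ ∷ [])) (template i j k 0F) ∷
             instantiate (lookup (y₁ ∷ y₂ ∷ y₃ ∷ y₄ ∷ [])) (template i j k 1F) ∷ []
newBlocks≡ 0F j k _ _ _ _ = refl
newBlocks≡ 1F j k _ _ _ _ = refl
newBlocks≡ 2F j k _ _ _ _ = refl
newBlocks≡ 3F j k _ _ _ _ = refl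
newBlocks≡ 4F j k _ _ _ _ = refl
newBlocks≡ 5F j k _ _ _ _ = refl

template-size : ∀ i j k h →
  ∑[ n < 4 ] (𝟙 (occupies (template i j k h) n 0F) + 𝟙 (occupies (template i j k h) n 1F)) ≡ 4
template-size = toWitness {a? = all? λ i → all? λ j → all? λ k → all? λ h →
  ∑[ n < 4 ] (𝟙 (occupies (template i j k h) n 0F) + 𝟙 (occupies (template i j k h) n 1F)) ℕ.≟ 4} _

template-proj-size : ∀ i j k h →
  ∑[ n < 4 ] 𝟙 (occupies (template i j k h) n 0F ∨ occupies (template i j k h) n 1F) ≡ 3
template-proj-size = toWitness {a? = all? λ i → all? λ j → all? λ k → all? λ h →
  ∑[ n < 4 ] 𝟙 (occupies (template i j k h) n 0F ∨ occupies (template i j k h) n 1F) ℕ.≟ 3} _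

template-halves : ∀ i j k n m → occupies (template i j k 0F) n m ≡ not (occupies (template i j k 1F) n m)
template-halves = toWitness {a? = all? λ i → all? λ j → all? λ k → all? λ n → all? λ m →
  occupies (template i j k 0F) n m 𝔹.≟ not (occupies (template i j k 1F) n m)} _

-- i is read off from the doubled and the missing point, then j and k from the single points.
template-determines : ∀ i j k h i′ j′ k′ h′ →
  (∀ n m → occupies (template i j k h) n m ≡ occupies (template i′ j′ k′ h′) n m) →
  i ≡ i′ × j ≡ j′ × k ≡ k′
template-determines = toWitness {a? = all? λ i → all? λ j → all? λ k → all? λ h →
  all? λ i′ → all? λ j′ → all? λ k′ → all? λ h′ →
  (all? λ n → all? λ m → occupies (template i j k h) n m 𝔹.≟ occupies (template i′ j′ k′ h′) n m) →-dec
  (i ≟ i′ ×-dec j ≟ j′ ×-dec k ≟ k′)} _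

record Enumeration {t} (b : Subset t) : Set where
  field
    y₁ y₂ y₃ y₄ : Fin t
    elems≡ : elems b ≡ y₁ ∷ y₂ ∷ y₃ ∷ y₄ ∷ []

  point : Fin 4 → Fin t
  point = lookup (y₁ ∷ y₂ ∷ y₃ ∷ y₄ ∷ [])

  point-injective : ∀ {a c} → point a ≡ point c → a ≡ c
  point-injective = lookup-injective (subst Unique elems≡ elems-unique)

  point∈ : ∀ a → point a ∈ₛ b
  point∈ a = ∈-elems⁻ (subst (point a ∈_) (sym elems≡) (∈-lookup a))

  ∈⇒point : ∀ {y} → y ∈ₛ b → ∃ λ a → point a ≡ y
  ∈⇒point y∈b = let y∈ys = subst (_ ∈_) elems≡ (∈-elems⁺ y∈b) in
    Any.index y∈ys , sym (lookup-index y∈ys)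

  blockImage≡ : ∀ i j k → blockImage i j k b ≡
                instantiate point (template i j k 0F) ∷ instantiate point (template i j k 1F) ∷ []
  blockImage≡ i j k rewrite elems≡ = newBlocks≡ i j k y₁ y₂ y₃ y₄

enumerate : ∀ {t} (b : Subset t) → ∣ b ∣ ≡ 4 → Enumeration b
enumerate b ∣b∣≡4 with elems b in elems≡ | trans (sym ∣b∣≡4) (∣p∣≡length-elems {p = b})
... | y₁ ∷ y₂ ∷ y₃ ∷ y₄ ∷ [] | _ = record { elems≡ = elems≡ }

module BlockImage {t} {b : Subset t} (e : Enumeration b) where

  open Enumeration e

  private
    half : Fin 6 → Fin 2 → Fin 2 → Fin 2 → Subset (t * 2)
    half i j k h = instantiate point (template i j k h)

    ∈-blockImage⁻ : ∀ {i j k X} → X ∈ blockImage i j k b → ∃ λ h → X ≡ half i j k h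
    ∈-blockImage⁻ {i} {j} {k} {X} X∈ with subst (X ∈_) (blockImage≡ i j k) X∈
    ... | here X≡         = 0F , X≡
    ... | there (here X≡) = 1F , X≡

    ∈ᵇ-half : ∀ i j k h a m → pt (point a) m ∈ᵇ half i j k h ≡ occupies (template i j k h) a m
    ∈ᵇ-half i j k h a m =
      trans (∈ᵇ-instantiate point (template i j k h) (point a) m) (hits-image point-injective (template i j k h) a m)

    ∈-half⇒point : ∀ {i j k h y m} → pt y m ∈ₛ half i j k h → ∃ λ a → point a ≡ y
    ∈-half⇒point {i} {j} {k} {h} {y} {m} y∈ with any? (λ a → point a ≟ y)
    ... | yes found = found
    ... | no ∄a = contradiction
      (trans (sym (∈ₛ⇒∈ᵇ y∈)) (trans (∈ᵇ-instantiate point (template i j k h) y m)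
                                      (hits-outside (λ a e → ∄a (a , e)) (template i j k h) m)))
      λ ()

    halves-disjoint : ∀ i j k → Disjoint (half i j k 0F) (half i j k 1F)
    halves-disjoint i j k (p , p∈both)
      with y , m , refl ← combine-surjective {t} {2} p
      with p∈₀ , p∈₁ ← x∈p∩q⁻ (half i j k 0F) _ p∈both
      with a , refl ← ∈-half⇒point {i} {j} {k} {0F} p∈₀ =
      contradiction (trans (sym occ₀) (trans (template-halves i j k a m) (cong not occ₁))) λ ()
      where
      occ₀ : occupies (template i j k 0F) a m ≡ true
      occ₀ = trans (sym (∈ᵇ-half i j k 0F a m)) (∈ₛ⇒∈ᵇ p∈₀)
      occ₁ : occupies (template i j k 1F) a m ≡ true
      occ₁ = trans (sym (∈ᵇ-half i j k 1F a m)) (∈ₛ⇒∈ᵇ p∈₁)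

  ∈-blockImage⇒∣X∣≡4 : ∀ {i j k X} → X ∈ blockImage i j k b → ∣ X ∣ ≡ 4
  ∈-blockImage⇒∣X∣≡4 {i} {j} {k} X∈ with h , refl ← ∈-blockImage⁻ X∈ =
    trans (∣instantiate∣ point-injective (template i j k h)) (template-size i j k h)

  ∈-blockImage⇒∣proj∣≡3 : ∀ {i j k X} → X ∈ blockImage i j k b → ∣ proj t X ∣ ≡ 3
  ∈-blockImage⇒∣proj∣≡3 {i} {j} {k} X∈ with h , refl ← ∈-blockImage⁻ X∈ =
    trans (∣proj-instantiate∣ point-injective (template i j k h)) (template-proj-size i j k h)

  ∈-blockImage⇒proj⊆ : ∀ {i j k X} → X ∈ blockImage i j k b → proj t X ⊆ b
  ∈-blockImage⇒proj⊆ {i} {j} {k} X∈ y∈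
    with h , refl ← ∈-blockImage⁻ X∈
    with m , ym∈ ← ∈proj⁻ y∈
    with a , refl ← ∈-half⇒point {i} {j} {k} {h} ym∈ = point∈ a

  blockImage-disjoint : ∀ i j k → AllPairs Disjoint (blockImage i j k b)
  blockImage-disjoint i j k =
    subst (AllPairs Disjoint) (sym (blockImage≡ i j k)) ((halves-disjoint i j k All.∷ All.[]) ∷ All.[] ∷ [])

  blockImage-covers : ∀ i j k m {y} → y ∈ₛ b → ∃ λ X → X ∈ blockImage i j k b × pt y m ∈ₛ X
  blockImage-covers i j k m y∈b
    with a , refl ← ∈⇒point y∈b
    with occupies (template i j k 1F) a m in occ₁
  ... | true  = half i j k 1F , subst (half i j k 1F ∈_) (sym (blockImage≡ i j k)) (there (here refl)) ,
                ∈ᵇ⇒∈ₛ (trans (∈ᵇ-half i j k 1F a m) occ₁)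
  ... | false = half i j k 0F , subst (half i j k 0F ∈_) (sym (blockImage≡ i j k)) (here refl) ,
                ∈ᵇ⇒∈ₛ (trans (∈ᵇ-half i j k 0F a m) (trans (template-halves i j k a m) (cong not occ₁)))

  blockImage-determines : ∀ {i j k i′ j′ k′ X} → X ∈ blockImage i j k b → X ∈ blockImage i′ j′ k′ b →
                          i ≡ i′ × j ≡ j′ × k ≡ k′
  blockImage-determines {i} {j} {k} {i′} {j′} {k′} X∈ X∈′
    with h , refl ← ∈-blockImage⁻ X∈
    with h′ , eq ← ∈-blockImage⁻ X∈′ =
    template-determines i j k h i′ j′ k′ h′ λ a m →
      trans (sym (∈ᵇ-half i j k h a m)) (trans (cong (pt (point a) m ∈ᵇ_) eq) (∈ᵇ-half i′ j′ k′ h′ a m))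

-- The classes R_{i,j,k}

module _ {t} {R : List (Subset t)} (i : Fin 6) (j k : Fin 2) where

  ∈-classRijk⁻ : ∀ {X} → X ∈ classRijk R i j k → ∃ λ b → b ∈ R × X ∈ blockImage i j k b
  ∈-classRijk⁻ X∈ = find (∈-concatMap⁻ (blockImage i j k) X∈)

  classRijk-proj-sizes : All (λ b → ∣ b ∣ ≡ 4) R → All (λ X → ∣ proj t X ∣ ≡ 3) (classRijk R i j k)
  classRijk-proj-sizes sizes = All.tabulate λ X∈ →
    let b , b∈R , X∈img = ∈-classRijk⁻ X∈
    in BlockImage.∈-blockImage⇒∣proj∣≡3 (enumerate b (All.lookup sizes b∈R)) {i} {j} {k} X∈img

  classRijk-isParallelClass : IsParallelClass R → IsParallelClass (classRijk R i j k)
  classRijk-isParallelClass (sizes , disjoint , covers) = sizes′ , disjoint′ , covers′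
    where
    sizes′ : All (λ X → ∣ X ∣ ≡ 4) (classRijk R i j k)
    sizes′ = All.tabulate λ X∈ →
      let b , b∈R , X∈img = ∈-classRijk⁻ X∈
      in BlockImage.∈-blockImage⇒∣X∣≡4 (enumerate b (All.lookup sizes b∈R)) {i} {j} {k} X∈img

    disjoint′ : AllPairs Disjoint (classRijk R i j k)
    disjoint′ = AllPairs-concatMap⁺ (blockImage i j k) sizes disjoint
      (λ {b} ∣b∣≡4 → BlockImage.blockImage-disjoint (enumerate b ∣b∣≡4) i j k)
      (λ {b} {c} ∣b∣≡4 ∣c∣≡4 b⊥c X∈ Y∈ → disjoint-by-proj
        (BlockImage.∈-blockImage⇒proj⊆ (enumerate b ∣b∣≡4) {i} {j} {k} X∈)
        (BlockImage.∈-blockImage⇒proj⊆ (enumerate c ∣c∣≡4) {i} {j} {k} Y∈) b⊥c)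

    covers′ : ∀ p → ∃ λ X → X ∈ classRijk R i j k × p ∈ₛ X
    covers′ p with y , m , refl ← combine-surjective {t} {2} p
              with b , b∈R , y∈b ← covers y
              with X , X∈img , p∈X ← BlockImage.blockImage-covers (enumerate b (All.lookup sizes b∈R)) i j k m y∈b =
      X , ∈-concatMap⁺ (blockImage i j k) (lose b∈R X∈img) , p∈X

module _ {t} {B : List (Subset t)} (sqs : IsSQS t B) {rs} (resolution : IsResolution B rs) where

  private
    ∈B : ∀ {c} a → c ∈ lookup rs a → c ∈ B
    ∈B a c∈ = ∈-resp-↭ (proj₂ resolution) (∈-concat⁺′ c∈ (∈-lookup {xs = rs} a))

    enumeration : ∀ {c} a → c ∈ lookup rs a → Enumeration c
    enumeration {c} a c∈ = enumerate c (All.lookup (proj₁ (proj₂ sqs)) (∈B a c∈))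

  same-block : ∀ {a a′ c c′ i j k m r s X} → c ∈ lookup rs a → c′ ∈ lookup rs a′ →
               X ∈ blockImage i j k c → X ∈ blockImage m r s c′ → c ≡ c′
  same-block {a} {a′} {c} {c′} {i} {j} {k} {m} {r} {s} {X} c∈ c′∈ X∈c X∈c′ =
    proj₂ (proj₂ (proj₂ sqs) (proj t X) (BlockImage.∈-blockImage⇒∣proj∣≡3 (enumeration a c∈) {i} {j} {k} X∈c))
      c c′ (∈B a c∈) (∈B a′ c′∈)
      (BlockImage.∈-blockImage⇒proj⊆ (enumeration a c∈) {i} {j} {k} X∈c)
      (BlockImage.∈-blockImage⇒proj⊆ (enumeration a′ c′∈) {m} {r} {s} X∈c′)

  same-class : ∀ {a a′ c} → c ∈ lookup rs a → c ∈ lookup rs a′ → a ≡ a′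
  same-class {a} {a′} = concat-unique-index rs unique-concat a a′
    where
    unique-concat : Unique (concat rs)
    unique-concat = PermutationSetoid.Unique-resp-↭ (setoid _) (↭⇒↭ₛ (↭-sym (proj₂ resolution))) (proj₁ sqs)

  classes-disjoint : ∀ (a a′ : Fin (length rs)) i j k m r s → (a , i , j , k) ≢ (a′ , m , r , s) →
                     ∀ X → X ∈ classRijk (lookup rs a) i j k → X ∉ classRijk (lookup rs a′) m r s
  classes-disjoint a a′ i j k m r s different X X∈ X∈′
    with b , b∈Ra , X∈img ← ∈-classRijk⁻ {R = lookup rs a} i j k X∈
    with b′ , b′∈Ra′ , X∈img′ ← ∈-classRijk⁻ {R = lookup rs a′} m r s X∈′
    with refl ← same-block {a} {a′} b∈Ra b′∈Ra′ X∈img X∈img′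
    with refl ← same-class {a} {a′} b∈Ra b′∈Ra′
    with refl , refl , refl ← BlockImage.blockImage-determines (enumeration a b∈Ra) X∈img X∈img′ =
    different refl

allClasses-length : ∀ {t} .{{_ : NonZero t}} {B : List (Subset t)} {rs} →
                    IsSQS t B → IsResolution B rs → length (allClasses rs) ≡ 4 * (t ∸ 1) * (t ∸ 2)
allClasses-length {t} {B} {rs} sqs resolution = begin
  length (allClasses rs)    ≡⟨ length-concatMap-const _ (λ _ → refl) rs ⟩
  length rs * 24            ≡⟨ *-assoc (length rs) 6 4 ⟨
  length rs * 6 * 4         ≡⟨ cong (_* 4) (resolution-length sqs resolution) ⟩
  (t ∸ 1) * (t ∸ 2) * 4     ≡⟨ *-comm ((t ∸ 1) * (t ∸ 2)) 4 ⟩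
  4 * ((t ∸ 1) * (t ∸ 2))   ≡⟨ *-assoc 4 (t ∸ 1) (t ∸ 2) ⟨
  4 * (t ∸ 1) * (t ∸ 2)     ∎

-- The congruence condition is used only to exclude t = 0, where the count fails: any number
-- of empty classes resolves the empty design.
lemma2 : (t : ℕ) → (t % 12 ≡ 4 ⊎ t % 12 ≡ 8) →
  (B : List (Subset t)) → IsSQS t B →
  (rs : List (List (Subset t))) → IsResolution B rs →
  (∀ R → R ∈ rs → ∀ i j k →
     IsParallelClass (classRijk R i j k) ×
     All (λ X → ∣ proj t X ∣ ≡ 3) (classRijk R i j k)) ×
  (∀ (a a′ : Fin (length rs)) i j k m r s →
     (a , i , j , k) ≢ (a′ , m , r , s) →
     ∀ X → X ∈ classRijk (lookup rs a) i j k →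
     X ∉ classRijk (lookup rs a′) m r s) ×
  length (allClasses rs) ≡ 4 * (t ∸ 1) * (t ∸ 2)
lemma2 zero    (inj₁ ()) _ _ _ _
lemma2 zero    (inj₂ ()) _ _ _ _
lemma2 (suc _) _ B sqs rs resolution =
  (λ R R∈rs i j k → classRijk-isParallelClass i j k (parallel R∈rs) ,
                    classRijk-proj-sizes i j k (proj₁ (parallel R∈rs))) ,
  classes-disjoint sqs resolution ,
  allClasses-length sqs resolution
  where
  parallel : ∀ {R} → R ∈ rs → IsParallelClass R
  parallel = All.lookup (proj₁ resolution)
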